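{- Let $\mathbf P=(P,\leq,{}',0,1)$ be a finite pseudo-orthomodular poset, and let $M(x,y)=L(U(x,y'),y)$ and $R(x,y)=LU(L(x,y),x')$. Then $\mathrm{DM}(\mathbf P)$ is a complete orthomodular lattice. Moreover, $\mathrm{DM}(\mathbf P)$ is a left residuated lattice with respect to the operations $x\odot y=(x\vee y')\wedge y$ and $x\to y=(x\wedge y)\vee x'$ (obtained from $M$ and $R$ by replacing $U(a,b)$ and $LU(a,b)$ by $a\vee b$ and $L(a,b)$ by $a\wedge b$).
   Context: For $M\subseteq P$, $U(M)$, $L(M)$ denote the sets of upper and lower bounds of $M$; $LU(\cdot)=L(U(\cdot))$. A poset with complementation is a bounded poset with an antitone involution $'$ ($x\leq y\Rightarrow y'\leq x'$, $x''=x$) such that $L(x,x')=\{0\}$, $U(x,x')=\{1\}$. It is pseudo-orthomodular if $L(U(L(x,y),y'),y)=L(x,y)$ for all $x,y$. The Dedekind-MacNeille completion $\mathrm{DM}(\mathbf P)$ is the complete lattice $(\{B\subseteq P\mid LU(B)=B\},\subseteq)$ with $P$ embedded via $x\mapsto L(x)$ and complementation $X\mapsto L(\{x'\mid x\in X\})$. An orthomodular lattice is a lattice with complementation satisfying $x\vee y=((x\vee y)\wedge y')\vee y$. A lattice with top $1$ is left residuated with respect to binary operations $\odot,\to$ if $x\odot 1=x=1\odot x$ and $x\odot y\leq z$ iff $x\leq y\to z$ for all $x,y,z$. -}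

module Defs where

open import Level using (0ℓ; suc)
open import Data.Nat using (ℕ)
open import Data.Fin using (Fin)
open import Data.Product using (Σ; ∃; _×_; _,_)
open import Data.Sum using (_⊎_)
open import Relation.Binary using (Rel; IsDecPartialOrder)
open import Relation.Binary.PropositionalEquality using (_≡_)
open import Relation.Unary using (Pred; _⊆_; _∪_; _∩_; _≐_)
open import Function.Bundles using (_⇔_)

record PosetWithComplementation (n : ℕ) : Set₁ where
  infix 4 _≤_
  field
    _≤_ : Rel (Fin n) 0ℓ
    isDecPartialOrder : IsDecPartialOrder _≡_ _≤_
    _′ : Fin n → Fin n
    𝟎 𝟏 : Fin n
    𝟎-least : ∀ x → 𝟎 ≤ x
    𝟏-greatest : ∀ x → x ≤ 𝟏
    ′-antitone : ∀ {x y} → x ≤ y → y ′ ≤ x ′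
    ′-involutive : ∀ x → (x ′) ′ ≡ x
    lower-compl : ∀ x z → z ≤ x → z ≤ x ′ → z ≡ 𝟎
    upper-compl : ∀ x z → x ≤ z → x ′ ≤ z → z ≡ 𝟏

module DM {n : ℕ} (P : PosetWithComplementation n) where
  open PosetWithComplementation P

  Subset : Set₁
  Subset = Pred (Fin n) 0ℓ

  ⟦_⟧ : Fin n → Subset
  ⟦ a ⟧ z = z ≡ a

  ⟦_∣_⟧ : Fin n → Fin n → Subset
  ⟦ a ∣ b ⟧ z = z ≡ a ⊎ z ≡ b

  L : Subset → Subset
  L M a = ∀ b → M b → a ≤ b

  U : Subset → Subset
  U M a = ∀ b → M b → b ≤ a

  LU : Subset → Subset
  LU M = L (U M)

  -- elements of DM(P): subsets B with LU(B) = B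
  Closed : Subset → Set
  Closed B = LU B ≐ B

  -- pseudo-orthomodularity: L(U(L(x,y),y'),y) = L(x,y)
  IsPseudoOrthomodular : Set
  IsPseudoOrthomodular =
    ∀ x y → L (U (L ⟦ x ∣ y ⟧ ∪ ⟦ y ′ ⟧) ∪ ⟦ y ⟧) ≐ L ⟦ x ∣ y ⟧

  infixr 7 _⊓_
  infixr 6 _⊔_
  _⊓_ : Subset → Subset → Subset
  X ⊓ Y = X ∩ Y

  _⊔_ : Subset → Subset → Subset
  X ⊔ Y = LU (X ∪ Y)

  _ᶜ : Subset → Subset
  X ᶜ = L (λ z → ∃ λ x → X x × z ≡ x ′)

  ⊥ᴰ ⊤ᴰ : Subset
  ⊥ᴰ = L ⟦ 𝟎 ⟧
  ⊤ᴰ = L ⟦ 𝟏 ⟧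

  _⊙_ : Subset → Subset → Subset
  X ⊙ Y = (X ⊔ Y ᶜ) ⊓ Y

  _⇒_ : Subset → Subset → Subset
  X ⇒ Y = (X ⊓ Y) ⊔ X ᶜ

  IsSup : {I : Set} → (I → Subset) → Subset → Set₁
  IsSup F S = Closed S × (∀ i → F i ⊆ S) × (∀ Z → Closed Z → (∀ i → F i ⊆ Z) → S ⊆ Z)

  IsInf : {I : Set} → (I → Subset) → Subset → Set₁
  IsInf F S = Closed S × (∀ i → S ⊆ F i) × (∀ Z → Closed Z → (∀ i → Z ⊆ F i) → Z ⊆ S)

  record CompleteOMLAndLeftResiduated : Set₁ where
    field
      sup-exists : (I : Set) (F : I → Subset) → (∀ i → Closed (F i)) → Σ Subset (IsSup F)
      inf-exists : (I : Set) (F : I → Subset) → (∀ i → Closed (F i)) → Σ Subset (IsInf F)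
      ⊓-closed : ∀ X Y → Closed X → Closed Y → Closed (X ⊓ Y)
      ⊔-closed : ∀ X Y → Closed X → Closed Y → Closed (X ⊔ Y)
      ᶜ-closed : ∀ X → Closed X → Closed (X ᶜ)
      ⊥-closed : Closed ⊥ᴰ
      ⊤-closed : Closed ⊤ᴰ
      ⊓-lb₁ : ∀ X Y → Closed X → Closed Y → X ⊓ Y ⊆ X
      ⊓-lb₂ : ∀ X Y → Closed X → Closed Y → X ⊓ Y ⊆ Y
      ⊓-glb : ∀ X Y Z → Closed X → Closed Y → Closed Z → Z ⊆ X → Z ⊆ Y → Z ⊆ X ⊓ Y
      ⊔-ub₁ : ∀ X Y → Closed X → Closed Y → X ⊆ X ⊔ Y
      ⊔-ub₂ : ∀ X Y → Closed X → Closed Y → Y ⊆ X ⊔ Y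
      ⊔-lub : ∀ X Y Z → Closed X → Closed Y → Closed Z → X ⊆ Z → Y ⊆ Z → X ⊔ Y ⊆ Z
      ⊥-least : ∀ X → Closed X → ⊥ᴰ ⊆ X
      ⊤-greatest : ∀ X → Closed X → X ⊆ ⊤ᴰ
      ᶜ-antitone : ∀ X Y → Closed X → Closed Y → X ⊆ Y → Y ᶜ ⊆ X ᶜ
      ᶜ-involutive : ∀ X → Closed X → (X ᶜ) ᶜ ≐ X
      ᶜ-meet : ∀ X → Closed X → X ⊓ X ᶜ ≐ ⊥ᴰ
      ᶜ-join : ∀ X → Closed X → X ⊔ X ᶜ ≐ ⊤ᴰ
      orthomodular : ∀ X Y → Closed X → Closed Y → X ⊔ Y ≐ ((X ⊔ Y) ⊓ Y ᶜ) ⊔ Y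
      ⊙-unitʳ : ∀ X → Closed X → X ⊙ ⊤ᴰ ≐ X
      ⊙-unitˡ : ∀ X → Closed X → ⊤ᴰ ⊙ X ≐ X
      residuation : ∀ X Y Z → Closed X → Closed Y → Closed Z → (X ⊙ Y ⊆ Z) ⇔ (X ⊆ Y ⇒ Z)

-- A
-- closed X is generated by its finitely many elements, so splitting off
-- principal pieces ↓q ⊆ X one at a time (induction on a list covering X)
-- proves the orthomodular law for all closed X ⊆ Y.

module Submission where

open import Defs
open import Data.Nat using (ℕ)
open import Data.Fin using (Fin)
open import Data.List using (List; []; _∷_; allFin)
open import Data.List.Relation.Unary.Any using (here; there)
open import Data.List.Membership.Propositional using (_∈_)
open import Data.List.Membership.Propositional.Properties using (∈-allFin)
open import Data.Product using (Σ; _,_; proj₁; proj₂)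
open import Data.Sum using (_⊎_; inj₁; inj₂)
open import Data.Empty using (⊥-elim)
open import Relation.Nullary using (¬_; yes; no)
open import Relation.Nullary.Decidable using (decidable-stable; ¬¬-excluded-middle)
open import Relation.Binary using (IsDecPartialOrder)
open import Relation.Binary.PropositionalEquality using (_≡_; refl; sym; subst)
open import Relation.Unary using (_⊆_; _≐_; _∪_; ⋃; ⋂)
open import Function.Bundles using (mk⇔)

module Ortholattice {n : ℕ} (P : PosetWithComplementation n) where
  open PosetWithComplementation P
  open DM P
  open IsDecPartialOrder isDecPartialOrder
    using (_≤?_) renaming (refl to ≤-refl; trans to ≤-trans)

  private variable
    a b p q : Fin n
    B C X X′ Y Y′ Z : Subset
    xs : List (Fin n)

  ′-swapʳ : a ≤ b ′ → b ≤ a ′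
  ′-swapʳ {a} {b} h = subst (_≤ a ′) (′-involutive b) (′-antitone h)

  ′-swapˡ : a ′ ≤ b → b ′ ≤ a
  ′-swapˡ {a} {b} h = subst (b ′ ≤_) (′-involutive a) (′-antitone h)

  ↓_ : Fin n → Subset
  ↓ p = L ⟦ p ⟧

  ↓-intro : a ≤ p → (↓ p) a
  ↓-intro a≤p _ refl = a≤p

  ↓-elim : (↓ p) a → a ≤ p
  ↓-elim a∈↓p = a∈↓p _ refl

  pair-lower : a ≤ p → a ≤ q → L ⟦ p ∣ q ⟧ a
  pair-lower a≤p _ _ (inj₁ refl) = a≤p
  pair-lower _ a≤q _ (inj₂ refl) = a≤q

  L-antitone : X ⊆ Y → L Y ⊆ L X
  L-antitone X⊆Y a∈LY b b∈X = a∈LY b (X⊆Y b∈X)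

  U-antitone : X ⊆ Y → U Y ⊆ U X
  U-antitone X⊆Y a∈UY b b∈X = a∈UY b (X⊆Y b∈X)

  LU-monotone : X ⊆ Y → LU X ⊆ LU Y
  LU-monotone X⊆Y = L-antitone (U-antitone X⊆Y)

  LU-extensive : X ⊆ LU X
  LU-extensive a∈X b b∈UX = b∈UX _ a∈X

  L-closed : Closed (L X)
  L-closed {X} = L-antitone (λ x∈X b b∈LX → b∈LX _ x∈X) , LU-extensive

  LU-closed : Closed (LU X)
  LU-closed = L-closed

  LU-least : Closed Z → X ⊆ Z → LU X ⊆ Z
  LU-least cZ X⊆Z a∈LUX = proj₁ cZ (LU-monotone X⊆Z a∈LUX)

  ↓-least : Closed X → X p → ↓ p ⊆ X
  ↓-least cX p∈X a∈↓p = proj₁ cX (λ t t∈UX → ≤-trans (↓-elim a∈↓p) (t∈UX _ p∈X))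

  𝟎-in-closed : Closed X → X 𝟎
  𝟎-in-closed cX = proj₁ cX (λ b _ → 𝟎-least b)

  -- Membership in a closed set is a conjunction of decidable order
  -- relations, hence ¬¬-stable; this licenses case splits on X q below.
  closed-stable : Closed X → ¬ ¬ X a → X a
  closed-stable {X} {a} cX ¬¬a∈X = proj₁ cX λ t t∈UX →
    decidable-stable (a ≤? t) (λ a≰t → ¬¬a∈X (λ a∈X → a≰t (t∈UX a a∈X)))

  ∩-closed : Closed X → Closed Y → Closed (X ⊓ Y)
  ∩-closed cX cY = (λ a∈LU → LU-least cX proj₁ a∈LU , LU-least cY proj₂ a∈LU)
                 , LU-extensive

  ⊔-ub₁ : X ⊆ X ⊔ Y
  ⊔-ub₁ a∈X = LU-extensive (inj₁ a∈X)

  ⊔-ub₂ : Y ⊆ X ⊔ Y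
  ⊔-ub₂ a∈Y = LU-extensive (inj₂ a∈Y)

  ⊔-lub : Closed Z → X ⊆ Z → Y ⊆ Z → X ⊔ Y ⊆ Z
  ⊔-lub cZ X⊆Z Y⊆Z = LU-least cZ λ { (inj₁ a∈X) → X⊆Z a∈X ; (inj₂ a∈Y) → Y⊆Z a∈Y }

  ⊔-monotone : X ⊆ X′ → Y ⊆ Y′ → X ⊔ Y ⊆ X′ ⊔ Y′
  ⊔-monotone {X = X} {X′ = X′} {Y = Y} {Y′ = Y′} X⊆X′ Y⊆Y′ =
    ⊔-lub {X = X} {Y = Y} LU-closed (λ a∈X → ⊔-ub₁ (X⊆X′ a∈X)) (λ a∈Y → ⊔-ub₂ (Y⊆Y′ a∈Y))

  ⊔-monotoneʳ : Y ⊆ Y′ → X ⊔ Y ⊆ X ⊔ Y′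
  ⊔-monotoneʳ {X = X} = ⊔-monotone {X = X} {X′ = X} (λ {a} a∈X → a∈X)

  ⊔-comm : X ⊔ Y ⊆ Y ⊔ X
  ⊔-comm = ⊔-lub LU-closed ⊔-ub₂ ⊔-ub₁

  ⊥-least : Closed X → ⊥ᴰ ⊆ X
  ⊥-least cX = ↓-least cX (𝟎-in-closed cX)

  ⊤-greatest : X ⊆ ⊤ᴰ
  ⊤-greatest {x = a} _ = ↓-intro (𝟏-greatest a)

  sup : {I : Set} (F : I → Subset) → IsSup F (LU (⋃ I F))
  sup F = LU-closed , (λ i a∈Fi → LU-extensive (i , a∈Fi))
        , λ Z cZ F⊆Z → LU-least cZ (λ { (i , a∈Fi) → F⊆Z i a∈Fi })

  inf : {I : Set} (F : I → Subset) → (∀ i → Closed (F i)) → IsInf F (⋂ I F)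
  inf F cF = ((λ a∈LU i → LU-least (cF i) (λ a∈⋂ → a∈⋂ i) a∈LU) , LU-extensive)
           , (λ i a∈⋂ → a∈⋂ i) , λ Z cZ Z⊆F a∈Z i → Z⊆F i a∈Z

  ᶜ-intro : (∀ {x} → X x → a ≤ x ′) → (X ᶜ) a
  ᶜ-intro below _ (x , x∈X , refl) = below x∈X

  ᶜ-elim : (X ᶜ) a → X b → a ≤ b ′
  ᶜ-elim a∈Xᶜ b∈X = a∈Xᶜ _ (_ , b∈X , refl)

  ᶜ-closed : Closed (X ᶜ)
  ᶜ-closed = L-closed

  ᶜ-antitone : X ⊆ Y → Y ᶜ ⊆ X ᶜ
  ᶜ-antitone X⊆Y a∈Yᶜ b (x , x∈X , b≡x′) = a∈Yᶜ b (x , X⊆Y x∈X , b≡x′)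

  ᶜᶜ-extensive : X ⊆ X ᶜ ᶜ
  ᶜᶜ-extensive a∈X = ᶜ-intro λ x∈Xᶜ → ′-swapʳ (ᶜ-elim x∈Xᶜ a∈X)

  U-ᶜ : U X b → (X ᶜ) (b ′)
  U-ᶜ b∈UX = ᶜ-intro λ x∈X → ′-antitone (b∈UX _ x∈X)

  ᶜᶜ-closed : Closed X → X ᶜ ᶜ ⊆ X
  ᶜᶜ-closed cX {a} a∈Xᶜᶜ = proj₁ cX λ t t∈UX →
    subst (a ≤_) (′-involutive t) (ᶜ-elim a∈Xᶜᶜ (U-ᶜ t∈UX))

  ᶜ-involutive : Closed X → X ᶜ ᶜ ≐ X
  ᶜ-involutive cX = ᶜᶜ-closed cX , ᶜᶜ-extensive

  ᶜ-reflect : Closed X → X ᶜ ⊆ Y ᶜ → Y ⊆ X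
  ᶜ-reflect cX Xᶜ⊆Yᶜ a∈Y = ᶜᶜ-closed cX (ᶜ-antitone Xᶜ⊆Yᶜ (ᶜᶜ-extensive a∈Y))

  ᶜ-swap : Closed Y → Y ᶜ ⊆ X → X ᶜ ⊆ Y
  ᶜ-swap cY Yᶜ⊆X a∈Xᶜ = ᶜᶜ-closed cY (ᶜ-antitone Yᶜ⊆X a∈Xᶜ)

  ᶜ-of-closure : X ᶜ ⊆ (LU X) ᶜ
  ᶜ-of-closure {x = a} a∈Xᶜ = ᶜ-intro λ x∈LUX →
    ′-swapʳ (x∈LUX (a ′) (λ y y∈X → ′-swapʳ (ᶜ-elim a∈Xᶜ y∈X)))

  de-morgan-⊔ : (X ⊔ Y) ᶜ ≐ X ᶜ ⊓ Y ᶜ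
  de-morgan-⊔ = (λ a∈ᶜ → ᶜ-antitone ⊔-ub₁ a∈ᶜ , ᶜ-antitone ⊔-ub₂ a∈ᶜ)
              , λ { (a∈Xᶜ , a∈Yᶜ) → ᶜ-of-closure (ᶜ-intro λ
                      { (inj₁ x∈X) → ᶜ-elim a∈Xᶜ x∈X ; (inj₂ y∈Y) → ᶜ-elim a∈Yᶜ y∈Y }) }

  de-morgan-⊓ : Closed X → Closed Y → (X ⊓ Y) ᶜ ≐ X ᶜ ⊔ Y ᶜ
  de-morgan-⊓ cX cY =
      ᶜ-swap LU-closed (λ a∈ᶜ → let (a∈Xᶜᶜ , a∈Yᶜᶜ) = proj₁ de-morgan-⊔ a∈ᶜ
                                 in ᶜᶜ-closed cX a∈Xᶜᶜ , ᶜᶜ-closed cY a∈Yᶜᶜ)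
    , ⊔-lub ᶜ-closed (ᶜ-antitone proj₁) (ᶜ-antitone proj₂)

  ᶜ-meet : Closed X → X ⊓ X ᶜ ≐ ⊥ᴰ
  ᶜ-meet {X} cX = (λ { {a} (a∈X , a∈Xᶜ) →
                       ↓-intro (subst (a ≤_) (lower-compl a a ≤-refl (ᶜ-elim a∈Xᶜ a∈X)) ≤-refl) })
                , λ a∈⊥ → ⊥-least cX a∈⊥ , ⊥-least ᶜ-closed a∈⊥

  ᶜ-join : Closed X → X ⊔ X ᶜ ≐ ⊤ᴰ
  ᶜ-join {X = X} cX = ⊤-greatest {X = X ⊔ X ᶜ} , λ {a} _ t t∈U → subst (a ≤_)
    (sym (upper-compl t t ≤-refl (t∈U (t ′) (inj₂ (U-ᶜ (λ x x∈X → t∈U x (inj₁ x∈X)))))))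
    (𝟏-greatest a)

  -- ⊤ᴰ is a two-sided unit for ⊙ (⊤ᴰᶜ = ⊥ᴰ lies in every closed set).
  ⊤ᶜ⊆⊥ : ⊤ᴰ ᶜ ⊆ ⊥ᴰ
  ⊤ᶜ⊆⊥ a∈⊤ᶜ = ↓-intro (≤-trans (ᶜ-elim a∈⊤ᶜ (↓-intro {p = 𝟏} ≤-refl)) (′-swapˡ (𝟏-greatest (𝟎 ′))))

  ⊙-unitʳ : Closed X → X ⊙ ⊤ᴰ ≐ X
  ⊙-unitʳ {X = X} cX =
      (λ (a∈X⊔⊤ᶜ , _) → ⊔-lub {X = X} {Y = ⊤ᴰ ᶜ} cX (λ a∈X → a∈X)
                           (λ a∈⊤ᶜ → ⊥-least cX (⊤ᶜ⊆⊥ a∈⊤ᶜ)) a∈X⊔⊤ᶜ)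
    , λ a∈X → ⊔-ub₁ a∈X , ⊤-greatest {X = X} a∈X

  ⊙-unitˡ : ⊤ᴰ ⊙ X ≐ X
  ⊙-unitˡ {X = X} = proj₂ , λ a∈X → ⊔-ub₁ {Y = X ᶜ} (⊤-greatest {X = X} a∈X) , a∈X

  ↓-ᶜ : (↓ p) ᶜ ≐ ↓ (p ′)
  ↓-ᶜ = (λ a∈ᶜ → ↓-intro (ᶜ-elim a∈ᶜ (↓-intro ≤-refl)))
      , λ a∈↓p′ → ᶜ-intro λ x∈↓p → ≤-trans (↓-elim a∈↓p′) (′-antitone (↓-elim x∈↓p))

  Principal : Subset → Set
  Principal X = Σ (Fin n) λ c → X ≐ ↓ c

  principal-ᶜ : Principal X → Principal (X ᶜ)
  principal-ᶜ (c , X⊆↓c , ↓c⊆X) =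
    c ′ , (λ a∈Xᶜ → proj₁ (↓-ᶜ {c}) (ᶜ-antitone ↓c⊆X a∈Xᶜ))
        , (λ a∈↓c′ → ᶜ-antitone X⊆↓c (proj₂ (↓-ᶜ {c}) a∈↓c′))

  -- The two forms of the orthomodular law for X ⊆ Y, resp. B ⊆ C:
  -- Y = X ∨ (Y ∧ Xᶜ), and (B ∨ Cᶜ) ∧ C = B.  Only the nontrivial
  -- inclusions are recorded.
  JoinLaw : Subset → Subset → Set
  JoinLaw X Y = Y ⊆ X ⊔ (Y ⊓ X ᶜ)

  MeetLaw : Subset → Subset → Set
  MeetLaw B C = (B ⊔ C ᶜ) ⊓ C ⊆ B

  join-from-meet : Closed Y → MeetLaw (Y ᶜ) (X ᶜ) → JoinLaw X Y
  join-from-meet {Y} {X} cY meet = ᶜ-reflect LU-closed λ a∈ᶜ →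
    let (a∈Xᶜ , a∈[Y⊓Xᶜ]ᶜ) = proj₁ de-morgan-⊔ a∈ᶜ
    in meet (proj₁ (de-morgan-⊓ cY ᶜ-closed) a∈[Y⊓Xᶜ]ᶜ , a∈Xᶜ)

  meet-from-join : Closed B → Closed C → JoinLaw (C ᶜ) (B ᶜ) → MeetLaw B C
  meet-from-join {B = B} {C = C} cB cC join = ᶜ-reflect {Y = (B ⊔ C ᶜ) ⊓ C} cB λ a∈Bᶜ →
    proj₂ (de-morgan-⊓ {X = B ⊔ C ᶜ} LU-closed cC)
      (⊔-comm {X = C ᶜ} (⊔-monotoneʳ {X = C ᶜ} (proj₂ (de-morgan-⊔ {X = B})) (join a∈Bᶜ)))

  -- Bookkeeping for the induction on the size of a closed set: a list xs
  -- covers X if every element of X other than 𝟎 occurs in xs.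
  CoveredBy : List (Fin n) → Subset → Set
  CoveredBy xs X = ∀ {a} → X a → a ≡ 𝟎 ⊎ a ∈ xs

  cover-skip : ¬ X q → CoveredBy (q ∷ xs) X → CoveredBy xs X
  cover-skip q∉X cov a∈X with cov a∈X
  ... | inj₁ a≡𝟎 = inj₁ a≡𝟎
  ... | inj₂ (here refl) = ⊥-elim (q∉X a∈X)
  ... | inj₂ (there a∈xs) = inj₂ a∈xs

  -- Removing the part below q′ removes q (as q ≤ q′ forces q = 𝟎).
  cover-shrink : CoveredBy (q ∷ xs) X → CoveredBy xs (X ⊓ (↓ q) ᶜ)
  cover-shrink cov (a∈X , a∈↓qᶜ) with cov a∈X
  ... | inj₁ a≡𝟎 = inj₁ a≡𝟎
  ... | inj₂ (here refl) = inj₁ (lower-compl _ _ ≤-refl (↓-elim (proj₁ ↓-ᶜ a∈↓qᶜ)))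
  ... | inj₂ (there a∈xs) = inj₂ a∈xs

  module FromOrthomodularLaw
    (orthomodular-law : ∀ {X Y} → Closed X → Closed Y → X ⊆ Y → JoinLaw X Y) where

    orthomodular-identity : Closed Y → X ⊔ Y ≐ ((X ⊔ Y) ⊓ Y ᶜ) ⊔ Y
    orthomodular-identity {Y = Y} {X = X} cY =
        (λ a∈X⊔Y → ⊔-comm {X = Y} (orthomodular-law cY LU-closed (⊔-ub₂ {X = X}) a∈X⊔Y))
      , ⊔-lub {X = (X ⊔ Y) ⊓ Y ᶜ} {Y = Y} LU-closed proj₁ ⊔-ub₂

    dual-orthomodular-law : Closed B → Closed C → B ⊆ C → MeetLaw B C
    dual-orthomodular-law {B = B} {C = C} cB cC B⊆C =
      meet-from-join cB cC (orthomodular-law {C ᶜ} {B ᶜ} ᶜ-closed ᶜ-closed (ᶜ-antitone B⊆C))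

    -- With A = X ⊔ Yᶜ: A = Yᶜ ⊔ (A ⊓ Y) and A ⊓ Y = X ⊙ Y ⊆ Y ⊓ Z.
    residuate : Closed Y → X ⊙ Y ⊆ Z → X ⊆ Y ⇒ Z
    residuate {Y = Y} {X = X} {Z = Z} cY ⊙⊆Z a∈X =
      ⊔-comm {X = Y ᶜ} (⊔-monotoneʳ {X = Y ᶜ} A⊓Y⊆Y⊓Z
        (orthomodular-law ᶜ-closed LU-closed (⊔-ub₂ {X = X}) (⊔-ub₁ {Y = Y ᶜ} a∈X)))
      where
      A⊓Y⊆Y⊓Z : (X ⊔ Y ᶜ) ⊓ Y ᶜ ᶜ ⊆ Y ⊓ Z
      A⊓Y⊆Y⊓Z (a∈A , a∈Yᶜᶜ) = let a∈Y = ᶜᶜ-closed cY a∈Yᶜᶜ in a∈Y , ⊙⊆Z (a∈A , a∈Y)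

    -- X ⊙ Y ⊆ ((Y ⊓ Z) ⊔ Yᶜ) ⊓ Y, which the meet law for Y ⊓ Z ⊆ Y bounds by Y ⊓ Z.
    unresiduate : Closed Y → Closed Z → X ⊆ Y ⇒ Z → X ⊙ Y ⊆ Z
    unresiduate {Y = Y} {Z = Z} {X = X} cY cZ X⊆Y⇒Z (a∈X⊔Yᶜ , a∈Y) =
      proj₂ (dual-orthomodular-law (∩-closed cY cZ) cY proj₁ (X⊔Yᶜ⊆ a∈X⊔Yᶜ , a∈Y))
      where
      X⊔Yᶜ⊆ : X ⊔ Y ᶜ ⊆ (Y ⊓ Z) ⊔ Y ᶜ
      X⊔Yᶜ⊆ = ⊔-lub {X = X} {Y = Y ᶜ} LU-closed X⊆Y⇒Z ⊔-ub₂

module Orthomodularity {n : ℕ} (P : PosetWithComplementation n)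
                       (pom : DM.IsPseudoOrthomodular P) where
  open PosetWithComplementation P
  open DM P
  open Ortholattice P
  open IsDecPartialOrder isDecPartialOrder using () renaming (trans to ≤-trans)

  private variable
    p q : Fin n
    B C X Y : Subset

  -- Pseudo-orthomodularity is the meet law for a closed B below a principal C:
  -- writing C = ↓y, it is applied to L(t, y) for each upper bound t of B.
  principal-meet : Principal C → Closed B → B ⊆ C → MeetLaw B C
  principal-meet {C = C} {B = B} (y , C⊆↓y , ↓y⊆C) cB B⊆C {a} (a∈B⊔Cᶜ , a∈C) =
    proj₁ cB λ t t∈UB → proj₁ (pom t y) (a∈lhs t∈UB) t (inj₁ refl)
    where
    bounds-B⊔Cᶜ : ∀ {t b} → U B t → U (L ⟦ t ∣ y ⟧ ∪ ⟦ y ′ ⟧) b → U (B ∪ C ᶜ) b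
    bounds-B⊔Cᶜ t∈UB b∈U c (inj₁ c∈B) =
      b∈U c (inj₁ (pair-lower (t∈UB c c∈B) (↓-elim (C⊆↓y (B⊆C c∈B)))))
    bounds-B⊔Cᶜ t∈UB b∈U c (inj₂ c∈Cᶜ) =
      ≤-trans (↓-elim (proj₁ (↓-ᶜ {y}) (ᶜ-antitone ↓y⊆C c∈Cᶜ))) (b∈U (y ′) (inj₂ refl))
    a∈lhs : ∀ {t} → U B t → L (U (L ⟦ t ∣ y ⟧ ∪ ⟦ y ′ ⟧) ∪ ⟦ y ⟧) a
    a∈lhs t∈UB b (inj₁ b∈U) = a∈B⊔Cᶜ b (bounds-B⊔Cᶜ t∈UB b∈U)
    a∈lhs t∈UB b (inj₂ refl) = ↓-elim (C⊆↓y a∈C)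

  principal-join : Closed Y → ↓ p ⊆ Y → JoinLaw (↓ p) Y
  principal-join {Y = Y} {p = p} cY ↓p⊆Y =
    join-from-meet {X = ↓ p} cY
      (principal-meet (principal-ᶜ (p , (λ h → h) , (λ h → h))) ᶜ-closed (ᶜ-antitone ↓p⊆Y))

  join-law-split : Closed X → Closed Y → X q → X ⊆ Y →
                   JoinLaw (X ⊓ (↓ q) ᶜ) (Y ⊓ (↓ q) ᶜ) → JoinLaw X Y
  join-law-split {X = X} {Y = Y} {q = q} cX cY q∈X X⊆Y join₁ a∈Y =
    ⊔-lub {X = ↓ q} {Y = Y₁} LU-closed (λ a∈↓q → ⊔-ub₁ (↓q⊆X a∈↓q)) Y₁⊆ (Y-split a∈Y)
    where
    X₁ Y₁ : Subset
    X₁ = X ⊓ (↓ q) ᶜ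
    Y₁ = Y ⊓ (↓ q) ᶜ
    ↓q⊆X : ↓ q ⊆ X
    ↓q⊆X = ↓-least cX q∈X
    X-split : X ⊆ ↓ q ⊔ X₁
    X-split = principal-join cX ↓q⊆X
    Y-split : Y ⊆ ↓ q ⊔ Y₁
    Y-split = principal-join cY (λ a∈↓q → X⊆Y (↓q⊆X a∈↓q))
    relative : Y₁ ⊓ X₁ ᶜ ⊆ Y ⊓ X ᶜ
    relative ((a∈Y , a∈↓qᶜ) , a∈X₁ᶜ) =
      a∈Y , ᶜ-antitone X-split (proj₂ (de-morgan-⊔ {X = ↓ q} {Y = X₁}) (a∈↓qᶜ , a∈X₁ᶜ))
    Y₁⊆ : Y₁ ⊆ X ⊔ (Y ⊓ X ᶜ)
    Y₁⊆ a∈Y₁ = ⊔-monotone {X = X₁} {X′ = X} {Y = Y₁ ⊓ X₁ ᶜ} proj₁ relative (join₁ a∈Y₁)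

  -- The join law for X ⊆ Y, by induction on a list covering X; whether q ∈ X
  -- is decided classically, which is sound since the goal is ¬¬-stable.
  join-law-finite : ∀ xs → CoveredBy xs X → Closed X → Closed Y → X ⊆ Y → JoinLaw X Y
  join-law-finite {X = X} [] cov cX cY X⊆Y {y} y∈Y = ⊔-ub₂ {X = X} (y∈Y , ᶜ-intro y≤x′)
    where
    y≤x′ : ∀ {x} → X x → y ≤ x ′
    y≤x′ x∈X with cov x∈X
    ... | inj₁ refl = ′-swapʳ (𝟎-least (y ′))
    ... | inj₂ ()
  join-law-finite (q ∷ xs) cov cX cY X⊆Y a∈Y = closed-stable LU-closed λ a∉ →
    ¬¬-excluded-middle λ where
      (yes q∈X) → a∉ (join-law-split cX cY q∈X X⊆Y
                        (join-law-finite xs (cover-shrink cov) (∩-closed cX ᶜ-closed)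
                           (∩-closed cY ᶜ-closed) (λ (a∈X , a∈↓qᶜ) → X⊆Y a∈X , a∈↓qᶜ)) a∈Y)
      (no q∉X) → a∉ (join-law-finite xs (cover-skip q∉X cov) cX cY X⊆Y a∈Y)

  orthomodular-law : Closed X → Closed Y → X ⊆ Y → JoinLaw X Y
  orthomodular-law = join-law-finite (allFin n) (λ {a} _ → inj₂ (∈-allFin a))

corollary4 : {n : ℕ} (P : PosetWithComplementation n) → DM.IsPseudoOrthomodular P → DM.CompleteOMLAndLeftResiduated P
corollary4 P pom = record
  { sup-exists   = λ I F _ → LU (⋃ I F) , sup F
  ; inf-exists   = λ I F cF → ⋂ I F , inf F cF
  ; ⊓-closed     = λ _ _ → ∩-closed
  ; ⊔-closed     = λ _ _ _ _ → LU-closed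
  ; ᶜ-closed     = λ _ _ → ᶜ-closed
  ; ⊥-closed     = L-closed
  ; ⊤-closed     = L-closed
  ; ⊓-lb₁        = λ _ _ _ _ → proj₁
  ; ⊓-lb₂        = λ _ _ _ _ → proj₂
  ; ⊓-glb        = λ _ _ _ _ _ _ Z⊆X Z⊆Y a∈Z → Z⊆X a∈Z , Z⊆Y a∈Z
  ; ⊔-ub₁        = λ _ Y _ _ → ⊔-ub₁ {Y = Y}
  ; ⊔-ub₂        = λ X _ _ _ → ⊔-ub₂ {X = X}
  ; ⊔-lub        = λ X Y _ _ _ cZ → ⊔-lub {X = X} {Y = Y} cZ
  ; ⊥-least      = λ _ → ⊥-least
  ; ⊤-greatest   = λ X _ → ⊤-greatest {X = X}
  ; ᶜ-antitone   = λ _ _ _ _ → ᶜ-antitone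
  ; ᶜ-involutive = λ _ → ᶜ-involutive
  ; ᶜ-meet       = λ _ → ᶜ-meet
  ; ᶜ-join       = λ _ → ᶜ-join
  ; orthomodular = λ _ _ _ → orthomodular-identity
  ; ⊙-unitʳ      = λ _ → ⊙-unitʳ
  ; ⊙-unitˡ      = λ _ _ → ⊙-unitˡ
  ; residuation  = λ _ _ _ _ cY cZ → mk⇔ (residuate cY) (unresiduate cY cZ)
  }
  where
  open DM P using (LU)
  open Ortholattice P
  open Orthomodularity P pom
  open FromOrthomodularLaw orthomodular-law
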